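{- (1) Let $D$ be a digraph and $\mathcal{P}=\{P_1,\dots,P_t\}$ ($t\ge 2$) a partition of $V(D)$ such that each $D[P_i]$ is acyclic. Assume $D[P_1\cup P_2]$ is acyclic and let $\mathcal{Q}=\{P_1\cup P_2,P_3,\dots,P_t\}$. Then $\vec\chi_{\mathcal{P}}(D)\le\vec\chi_{\mathcal{Q}}(D)\le\vec\chi_{\mathcal{P}}(D)+1$. (2) Let $G$ be a graph and $\mathcal{P}=\{P_1,\dots,P_t\}$ ($t\ge2$) a partition of $V(G)$ such that each $G[P_i]$ is a forest. Assume $G[P_1\cup P_2]$ is a forest and let $\mathcal{Q}=\{P_1\cup P_2,P_3,\dots,P_t\}$. Then ${\rm va}_{\mathcal{P}}(G)\le{\rm va}_{\mathcal{Q}}(G)\le{\rm va}_{\mathcal{P}}(G)+1$.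
   Context: For a digraph $D$ and a partition $\mathcal{P}$ of $V(D)$ into sets each inducing an acyclic subdigraph, the $\mathcal{P}$-dichromatic number $\vec\chi_{\mathcal{P}}(D)$ is the least number of colors in a coloring of $V(D)$ with no monochromatic directed cycle in which all vertices of each part of $\mathcal{P}$ receive the same color. For a graph $G$ and a partition $\mathcal{P}$ of $V(G)$ into sets each inducing a forest, the $\mathcal{P}$-vertex arboricity ${\rm va}_{\mathcal{P}}(G)$ is the least number of colors in a coloring of $V(G)$ with no monochromatic cycle in which all vertices of each part of $\mathcal{P}$ receive the same color. Digons count as directed cycles and bigons as cycles. -}

module Defs where

open import Data.Nat using (ℕ; zero; suc)
open import Data.Fin using (Fin; inject₁; fromℕ)
import Data.Fin as F
open import Data.Product using (Σ; _×_; _,_)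
open import Data.Sum using (_⊎_)
open import Relation.Binary.PropositionalEquality using (_≡_)
open import Relation.Nullary using (¬_)
open import Function.Definitions using (Injective; Surjective)

record Digraph (n : ℕ) : Set₁ where
  field
    Arc : Fin n → Fin n → Set

open Digraph public

-- A directed cycle of length (suc k): distinct vertices c 0, …, c k with
-- arcs c i → c (i+1) and c k → c 0.  (k = 0 is a loop, k = 1 a digon.)
record DiCycle {n : ℕ} (D : Digraph n) : Set where
  field
    len    : ℕ
    vtx    : Fin (suc len) → Fin n
    vtxInj : Injective _≡_ _≡_ vtx
    step   : (i : Fin len) → Arc D (vtx (inject₁ i)) (vtx (F.suc i))
    close  : Arc D (vtx (fromℕ len)) (vtx F.zero)

open DiCycle public

DiAcyclicOn : {n : ℕ} → Digraph n → (Fin n → Set) → Set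
DiAcyclicOn D S = (C : DiCycle D) → ¬ ((i : Fin (suc (len C))) → S (vtx C i))

-- (Multi)graphs: vertex set Fin n, m edges each with two ends
-- (parallel edges allowed, so bigons are cycles).

record Graph (n : ℕ) : Set where
  field
    nEdges : ℕ
    ends   : Fin nEdges → Fin n × Fin n

open Graph public

Joins : {n : ℕ} (G : Graph n) → Fin (nEdges G) → Fin n → Fin n → Set
Joins G e u v = (ends G e ≡ (u , v)) ⊎ (ends G e ≡ (v , u))

record Cycle {n : ℕ} (G : Graph n) : Set where
  field
    len     : ℕ
    vtx     : Fin (suc len) → Fin n
    vtxInj  : Injective _≡_ _≡_ vtx
    edg     : Fin (suc len) → Fin (nEdges G)
    edgInj  : Injective _≡_ _≡_ edg
    step    : (i : Fin len) → Joins G (edg (inject₁ i)) (vtx (inject₁ i)) (vtx (F.suc i))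
    close   : Joins G (edg (fromℕ len)) (vtx (fromℕ len)) (vtx F.zero)

ForestOn : {n : ℕ} → Graph n → (Fin n → Set) → Set
ForestOn G S = (C : Cycle G) → ¬ ((i : Fin (suc (Cycle.len C))) → S (Cycle.vtx C i))

-- Partitions of Fin n into t parts P_0..P_{t-1}, given by the map
-- vertex ↦ index of its part; parts are nonempty (surjectivity).

IsPartition : {n t : ℕ} → (Fin n → Fin t) → Set
IsPartition p = Surjective _≡_ _≡_ p

RespectsPartition : {n t k : ℕ} → (Fin n → Fin t) → (Fin n → Fin k) → Set
RespectsPartition p f = ∀ u v → p u ≡ p v → f u ≡ f v

ColourClass : {n k : ℕ} → (Fin n → Fin k) → Fin k → Fin n → Set
ColourClass f a v = f v ≡ a

DiProperColouring : {n k : ℕ} → Digraph n → (Fin n → Fin k) → Set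
DiProperColouring D f = ∀ a → DiAcyclicOn D (ColourClass f a)

ArbColouring : {n k : ℕ} → Graph n → (Fin n → Fin k) → Set
ArbColouring G f = ∀ a → ForestOn G (ColourClass f a)

PDiColourable : {n t : ℕ} → Digraph n → (Fin n → Fin t) → ℕ → Set
PDiColourable {n} D p k =
  Σ (Fin n → Fin k) λ f → RespectsPartition p f × DiProperColouring D f

PArbColourable : {n t : ℕ} → Graph n → (Fin n → Fin t) → ℕ → Set
PArbColourable {n} G p k =
  Σ (Fin n → Fin k) λ f → RespectsPartition p f × ArbColouring G f

open import Data.Nat using (_≤_)

IsPDichromaticNumber : {n t : ℕ} → Digraph n → (Fin n → Fin t) → ℕ → Set
IsPDichromaticNumber D p k = PDiColourable D p k × (∀ j → PDiColourable D p j → k ≤ j)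

IsPVertexArboricity : {n t : ℕ} → Graph n → (Fin n → Fin t) → ℕ → Set
IsPVertexArboricity G p k = PArbColourable G p k × (∀ j → PArbColourable G p j → k ≤ j)

merge01 : {s : ℕ} → Fin (suc (suc s)) → Fin (suc s)
merge01 F.zero            = F.zero
merge01 (F.suc F.zero)    = F.zero
merge01 (F.suc (F.suc i)) = F.suc i

InPart : {n t : ℕ} → (Fin n → Fin t) → Fin t → Fin n → Set
InPart p i v = p v ≡ i

module Submission where

-- Both parts of the theorem are instances of one argument about an
-- arbitrary hereditary property "Acyc" of vertex sets (acyclic in a
-- digraph, resp. a forest in a graph); the P-chromatic number is the least
-- k with a P-respecting k-colouring all of whose colour classes satisfy Acyc.
--
--  * Coarsening: a colouring respecting a coarser partition (one factoring
--    through p) respects p, so chi_P ≤ chi_Q.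
--  * One extra colour: from a P-colouring with k colours, give every vertex
--    of the merged part Q_0 = P_1 ∪ P_2 the new colour zero and shift all
--    other colours by one.  The new class is Q_0, which satisfies Acyc by
--    hypothesis; the others are subsets of old classes.  This respects Q
--    because Q agrees with P outside Q_0, so chi_Q ≤ chi_P + 1.

open import Defs
open import Data.Nat using (ℕ; suc; _≤_; _+_)
open import Data.Fin using (Fin; zero)
import Data.Fin as F
open import Data.Nat.Properties using (+-comm)
open import Data.Product using (Σ; _×_; _,_)
open import Function using (_∘_)
open import Relation.Binary.PropositionalEquality
  using (_≡_; refl; cong; subst; trans; sym)

merge01-suc : ∀ {s} (x : Fin (suc (suc s))) {i : Fin s} →
              merge01 x ≡ F.suc i → x ≡ F.suc (F.suc i)
merge01-suc (F.suc (F.suc j)) refl = refl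

RefinesOffZero : {n t u : ℕ} → (Fin n → Fin t) → (Fin n → Fin (suc u)) → Set
RefinesOffZero p q = ∀ x y {i} → q x ≡ F.suc i → q y ≡ F.suc i → p x ≡ p y

merge01-refinesOffZero : ∀ {n s} (p : Fin n → Fin (suc (suc s))) →
                         RefinesOffZero p (merge01 ∘ p)
merge01-refinesOffZero p x y qx qy =
  trans (merge01-suc (p x) qx) (sym (merge01-suc (p y) qy))

module PartitionColouring {n : ℕ} (Acyc : (Fin n → Set) → Set)
  (hereditary : ∀ {S T : Fin n → Set} → (∀ v → S v → T v) → Acyc T → Acyc S)
  where

  Colourable : {t : ℕ} → (Fin n → Fin t) → ℕ → Set
  Colourable q k =
    Σ (Fin n → Fin k) λ f → RespectsPartition q f × (∀ c → Acyc (ColourClass f c))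

  coarsening : ∀ {t t' k} (p : Fin n → Fin t) (m : Fin t → Fin t') →
               Colourable (m ∘ p) k → Colourable p k
  coarsening p m (f , respects , proper) =
    f , (λ u v same → respects u v (cong m same)) , proper

  newColour : ∀ {t k} → Fin (suc t) → Fin k → Fin (suc k)
  newColour zero      c = zero
  newColour (F.suc _) c = F.suc c

  extraColour : ∀ {t u k} (p : Fin n → Fin t) (q : Fin n → Fin (suc u)) →
                RefinesOffZero p q → Acyc (InPart q zero) →
                Colourable p k → Colourable q (suc k)
  extraColour {k = k} p q refines part0 (f , respects , proper) = g , respectsQ , properG
    where
    g : Fin n → Fin (suc k)
    g v = newColour (q v) (f v)

    respectsQ : RespectsPartition q g
    respectsQ u v same with q u in qu | q v in qv
    respectsQ u v refl | zero    | zero = refl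
    respectsQ u v refl | F.suc i | F.suc .i = cong F.suc (respects u v (refines u v qu qv))

    newClass⊆part0 : ∀ v → ColourClass g zero v → InPart q zero v
    newClass⊆part0 v _ with q v
    ... | zero = refl

    shiftedClass⊆old : ∀ c v → ColourClass g (F.suc c) v → ColourClass f c v
    shiftedClass⊆old c v _ with q v
    shiftedClass⊆old c v refl | F.suc _ = refl

    properG : ∀ c → Acyc (ColourClass g c)
    properG zero      = hereditary newClass⊆part0 part0
    properG (F.suc c) = hereditary (shiftedClass⊆old c) (proper c)

  mergeBounds : ∀ {s} (p : Fin n → Fin (suc (suc s))) →
                Acyc (InPart (merge01 ∘ p) zero) → ∀ a b →
                Colourable p a × (∀ j → Colourable p j → a ≤ j) →
                Colourable (merge01 ∘ p) b × (∀ j → Colourable (merge01 ∘ p) j → b ≤ j) →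
                a ≤ b × b ≤ a + 1
  mergeBounds p part0 a b (colP , leastP) (colQ , leastQ) =
    leastP b (coarsening p merge01 colQ) ,
    leastQ (a + 1) (subst (Colourable (merge01 ∘ p)) (+-comm 1 a)
      (extraColour p (merge01 ∘ p) (merge01-refinesOffZero p) part0 colP))

diAcyclic-hereditary : ∀ {n} (D : Digraph n) {S T : Fin n → Set} →
                       (∀ v → S v → T v) → DiAcyclicOn D T → DiAcyclicOn D S
diAcyclic-hereditary D S⊆T acyclicT C inS = acyclicT C (λ i → S⊆T _ (inS i))

forest-hereditary : ∀ {n} (G : Graph n) {S T : Fin n → Set} →
                    (∀ v → S v → T v) → ForestOn G T → ForestOn G S
forest-hereditary G S⊆T forestT C inS = forestT C (λ i → S⊆T _ (inS i))

lemma2p9 :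
    ((n s : ℕ) (D : Digraph n) (p : Fin n → Fin (suc (suc s))) →
      IsPartition p →
      (∀ i → DiAcyclicOn D (InPart p i)) →
      DiAcyclicOn D (InPart (λ v → merge01 (p v)) zero) →
      ∀ a b → IsPDichromaticNumber D p a →
        IsPDichromaticNumber D (λ v → merge01 (p v)) b →
        a ≤ b × b ≤ a + 1)
    ×
    ((n s : ℕ) (G : Graph n) (p : Fin n → Fin (suc (suc s))) →
      IsPartition p →
      (∀ i → ForestOn G (InPart p i)) →
      ForestOn G (InPart (λ v → merge01 (p v)) zero) →
      ∀ a b → IsPVertexArboricity G p a →
        IsPVertexArboricity G (λ v → merge01 (p v)) b →
        a ≤ b × b ≤ a + 1)
lemma2p9 =
  (λ n s D p _ _ merged →
     PartitionColouring.mergeBounds (DiAcyclicOn D) (diAcyclic-hereditary D) p merged) ,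
  (λ n s G p _ _ merged →
     PartitionColouring.mergeBounds (ForestOn G) (forest-hereditary G) p merged)
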